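{- Let $\mathcal{F}$ be a finite family of finite sets such that each member set of $\mathcal{F}$ contains an element of frequency $1$ in $\mathcal{F}$. Then $\langle\mathcal{F}\rangle$ satisfies the union closed conjecture.
   Context: For a family of sets $\mathcal{F}$, its universe $U(\mathcal{F})$ is the union of its member sets, and the frequency of an element $x$ in $\mathcal{F}$ is the number of member sets of $\mathcal{F}$ containing $x$. $\langle\mathcal{F}\rangle$ is the union-closed family generated by $\mathcal{F}$: all unions of subfamilies of $\mathcal{F}$, including the empty set. An element $x$ is abundant in a family $\mathcal{U}$ if its frequency in $\mathcal{U}$ is at least $|\mathcal{U}|/2$. A finite union-closed family $\mathcal{U}$ satisfies the union closed conjecture if either $\mathcal{U}=\{\emptyset\}$ or some element of $U(\mathcal{U})$ is abundant in $\mathcal{U}$. -}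

module Defs where

open import Data.Nat using (ℕ; _*_; _≥_)
open import Data.Bool using (Bool)
open import Data.Bool.Properties using () renaming (_≟_ to _≟ᵇ_)
open import Data.Fin using (Fin)
open import Data.Fin.Subset using (Subset; ⋃; ⊥) renaming (_∈_ to _∈ˢ_)
open import Data.Fin.Subset.Properties using (_∈?_)
open import Data.List using (List; []; _∷_; length; filter; map; deduplicate; concatMap)
open import Data.Vec.Properties using (≡-dec)
open import Relation.Binary.Definitions using (DecidableEquality)

-- Ground set: elements are drawn from Fin n (any finite family of finite
-- sets has a finite universe, which can be enumerated as Fin n).
-- A finite family of sets is a duplicate-free list of subsets of Fin n
-- (duplicate-freeness is imposed in the statement).

_≟ˢ_ : ∀ {n} → DecidableEquality (Subset n)
_≟ˢ_ = ≡-dec _≟ᵇ_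

freq : ∀ {n} → Fin n → List (Subset n) → ℕ
freq x 𝓕 = length (filter (x ∈?_) 𝓕)

U : ∀ {n} → List (Subset n) → Subset n
U = ⋃

subfamilies : ∀ {a} {A : Set a} → List A → List (List A)
subfamilies [] = [] ∷ []
subfamilies (x ∷ xs) = let r = subfamilies xs in r Data.List.++ map (x ∷_) r

-- ⟨𝓕⟩: all unions of subfamilies (including the empty union ∅),
-- as a duplicate-free list of sets
⟨_⟩ : ∀ {n} → List (Subset n) → List (Subset n)
⟨ 𝓕 ⟩ = deduplicate _≟ˢ_ (map ⋃ (subfamilies 𝓕))

Abundant : ∀ {n} → Fin n → List (Subset n) → Set
Abundant x 𝓤 = 2 * freq x 𝓤 ≥ length 𝓤

open import Data.Sum using (_⊎_)
open import Data.Product using (∃; _×_)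
open import Relation.Binary.PropositionalEquality using (_≡_)

SatisfiesUCC : ∀ {n} → List (Subset n) → Set
SatisfiesUCC {n} 𝓤 = (𝓤 ≡ ⊥ ∷ []) ⊎ ∃ λ (x : Fin n) → x ∈ˢ U 𝓤 × Abundant x 𝓤

-- A member S of 𝓕 lies in a subfamily s iff S's private element lies in ⋃ s, so a union
-- determines its subfamily and ⟨ 𝓕 ⟩ lists the unions of all 2^|𝓕| subfamilies without
-- repetition. The private element of any fixed member A lies exactly in the unions of the
-- subfamilies containing A, which are half of them.
module Submission where

open import Defs
open import Data.Nat using (ℕ; _*_; _+_)
open import Data.Nat.Properties using (≤-reflexive; +-identityʳ)
open import Data.Fin using (Fin)
open import Data.Fin.Subset using (Subset; ⋃) renaming (_∈_ to _∈ˢ_)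
open import Data.Fin.Subset.Properties using (_∈?_; ∉⊥; x∈p∪q⁻; x∈p∪q⁺)
open import Data.List using (List; []; _∷_; _++_; map; length; filter; deduplicate)
open import Data.List.Properties using (filter-all; filter-none; filter-++; length-++; length-map; map-++; ∷-injectiveʳ)
open import Data.List.Membership.Propositional using (_∈_)
open import Data.List.Membership.Propositional.Properties using (∈-map⁻; ∈-map⁺; ∈-++⁻; ∈-++⁺ˡ; ∈-++⁺ʳ; ∈-filter⁺)
open import Data.List.Relation.Binary.Subset.Propositional using (_⊆_)
open import Data.List.Relation.Binary.Disjoint.Propositional using (Disjoint)
open import Data.List.Relation.Unary.Any using (here; there)
open import Data.List.Relation.Unary.All as All using (All)
open import Data.List.Relation.Unary.All.Properties as All using ()
open import Data.List.Relation.Unary.AllPairs as AllPairs using ()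
open import Data.List.Relation.Unary.Unique.Propositional using (Unique)
open import Data.List.Relation.Unary.Unique.Propositional.Properties as Unique using ()
open import Data.Product using (∃; _×_; _,_)
open import Data.Sum using (_⊎_; inj₁; inj₂)
open import Function using (_∘_)
open import Level using (Level)
open import Relation.Binary.Definitions using (DecidableEquality)
open import Relation.Nullary using (¬_; ¬?; contradiction)
open import Relation.Binary.PropositionalEquality using (_≡_; _≢_; refl; sym; trans; cong; cong₂; subst; module ≡-Reasoning)

private
  variable
    a b : Level
    A : Set a
    B : Set b
    n : ℕ

x∈⋃⁻ : ∀ {x : Fin n} 𝓢 → x ∈ˢ ⋃ 𝓢 → ∃ λ S → S ∈ 𝓢 × x ∈ˢ S
x∈⋃⁻ []      x∈⋃ = contradiction x∈⋃ ∉⊥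
x∈⋃⁻ (S ∷ 𝓢) x∈⋃ with x∈p∪q⁻ S (⋃ 𝓢) x∈⋃
... | inj₁ x∈S = S , here refl , x∈S
... | inj₂ x∈⋃𝓢 with x∈⋃⁻ 𝓢 x∈⋃𝓢
...   | T , T∈𝓢 , x∈T = T , there T∈𝓢 , x∈T

x∈⋃⁺ : ∀ {x : Fin n} {S 𝓢} → x ∈ˢ S → S ∈ 𝓢 → x ∈ˢ ⋃ 𝓢
x∈⋃⁺ x∈S (here refl)  = x∈p∪q⁺ (inj₁ x∈S)
x∈⋃⁺ x∈S (there S∈𝓢) = x∈p∪q⁺ (inj₂ (x∈⋃⁺ x∈S S∈𝓢))

length≡1⇒∈-≡ : ∀ {xs : List A} {x y} → length xs ≡ 1 → x ∈ xs → y ∈ xs → x ≡ y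
length≡1⇒∈-≡ {xs = []}          ()
length≡1⇒∈-≡ {xs = _ ∷ _ ∷ _}   ()
length≡1⇒∈-≡ {xs = _ ∷ []} refl (here refl) (here refl) = refl

freq≡1⇒≡ : ∀ {x : Fin n} {𝓕 S T} → freq x 𝓕 ≡ 1 →
           S ∈ 𝓕 → x ∈ˢ S → T ∈ 𝓕 → x ∈ˢ T → S ≡ T
freq≡1⇒≡ {x = x} freq≡1 S∈𝓕 x∈S T∈𝓕 x∈T =
  length≡1⇒∈-≡ freq≡1 (∈-filter⁺ (x ∈?_) S∈𝓕 x∈S) (∈-filter⁺ (x ∈?_) T∈𝓕 x∈T)

freq-++ : ∀ (x : Fin n) 𝓢 𝓣 → freq x (𝓢 ++ 𝓣) ≡ freq x 𝓢 + freq x 𝓣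
freq-++ x 𝓢 𝓣 = trans (cong length (filter-++ (x ∈?_) 𝓢 𝓣)) (length-++ (filter (x ∈?_) 𝓢))

freq-all : ∀ {x : Fin n} {𝓢} → All (x ∈ˢ_) 𝓢 → freq x 𝓢 ≡ length 𝓢
freq-all {x = x} all∈ = cong length (filter-all (x ∈?_) all∈)

freq-none : ∀ {x : Fin n} {𝓢} → All (¬_ ∘ (x ∈ˢ_)) 𝓢 → freq x 𝓢 ≡ 0
freq-none {x = x} all∉ = cong length (filter-none (x ∈?_) all∉)

map⁺-injectiveOn : ∀ {f : A → B} {xs} → (∀ {x y} → x ∈ xs → y ∈ xs → f x ≡ f y → x ≡ y) →
                   Unique xs → Unique (map f xs)
map⁺-injectiveOn inj AllPairs.[]        = AllPairs.[]
map⁺-injectiveOn inj (x≢xs AllPairs.∷ u) =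
  All.map⁺ (All.tabulate λ y∈ fx≡fy → All.lookup x≢xs y∈ (inj (here refl) (there y∈) fx≡fy))
  AllPairs.∷ map⁺-injectiveOn (λ x∈ y∈ → inj (there x∈) (there y∈)) u

deduplicate-unique : ∀ (_≟_ : DecidableEquality A) {xs} → Unique xs → deduplicate _≟_ xs ≡ xs
deduplicate-unique _≟_ AllPairs.[]                       = refl
deduplicate-unique _≟_ {x ∷ xs} (x≢xs AllPairs.∷ u) rewrite deduplicate-unique _≟_ u =
  cong (x ∷_) (filter-all (¬? ∘ (x ≟_)) x≢xs)

∈-subfamilies-∷⁻ : ∀ {x : A} xs {s} → s ∈ subfamilies (x ∷ xs) →
                   s ∈ subfamilies xs ⊎ ∃ λ t → t ∈ subfamilies xs × s ≡ x ∷ t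
∈-subfamilies-∷⁻ {x = x} xs s∈ with ∈-++⁻ (subfamilies xs) s∈
... | inj₁ s∈r    = inj₁ s∈r
... | inj₂ s∈x∷r = inj₂ (∈-map⁻ (x ∷_) s∈x∷r)

∈-subfamilies⇒⊆ : ∀ (xs : List A) {s} → s ∈ subfamilies xs → s ⊆ xs
∈-subfamilies⇒⊆ []       (here refl) ()
∈-subfamilies⇒⊆ (x ∷ xs) s∈ y∈s with ∈-subfamilies-∷⁻ xs s∈ | y∈s
... | inj₁ s∈r              | _           = there (∈-subfamilies⇒⊆ xs s∈r y∈s)
... | inj₂ (t , t∈r , refl) | here refl   = here refl
... | inj₂ (t , t∈r , refl) | there y∈t = there (∈-subfamilies⇒⊆ xs t∈r y∈t)

[]∈subfamilies : ∀ (xs : List A) → [] ∈ subfamilies xs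
[]∈subfamilies []       = here refl
[]∈subfamilies (x ∷ xs) = ∈-++⁺ˡ ([]∈subfamilies xs)

∉-subfamilies : ∀ {x : A} {xs s} → All (x ≢_) xs → s ∈ subfamilies xs → ¬ x ∈ s
∉-subfamilies {xs = xs} x∉xs s∈ x∈s = All.lookup x∉xs (∈-subfamilies⇒⊆ xs s∈ x∈s) refl

⊆-∷⇒⊆ : ∀ {x : A} {s t} → ¬ x ∈ s → s ⊆ x ∷ t → s ⊆ t
⊆-∷⇒⊆ x∉s s⊆x∷t y∈s with s⊆x∷t y∈s
... | here refl  = contradiction y∈s x∉s
... | there y∈t = y∈t

subfamilies-unique : ∀ {xs : List A} → Unique xs → Unique (subfamilies xs)
subfamilies-unique {xs = []}     _                     = All.[] AllPairs.∷ AllPairs.[]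
subfamilies-unique {xs = x ∷ xs} (x∉xs AllPairs.∷ u) =
  Unique.++⁺ r-unique (Unique.map⁺ ∷-injectiveʳ r-unique) disjoint
  where
    r-unique : Unique (subfamilies xs)
    r-unique = subfamilies-unique u
    disjoint : Disjoint (subfamilies xs) (map (x ∷_) (subfamilies xs))
    disjoint (s∈r , s∈x∷r) with ∈-map⁻ (x ∷_) s∈x∷r
    ... | _ , _ , refl = ∉-subfamilies x∉xs s∈r (here refl)

subfamilies-⊆-antisym : ∀ {xs : List A} → Unique xs → ∀ {s t} →
                        s ∈ subfamilies xs → t ∈ subfamilies xs → s ⊆ t → t ⊆ s → s ≡ t
subfamilies-⊆-antisym {xs = []} _ (here refl) (here refl) _ _ = refl
subfamilies-⊆-antisym {xs = x ∷ xs} (x∉xs AllPairs.∷ u) s∈ t∈ s⊆t t⊆s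
  with ∈-subfamilies-∷⁻ xs s∈ | ∈-subfamilies-∷⁻ xs t∈
... | inj₁ s∈r | inj₁ t∈r = subfamilies-⊆-antisym u s∈r t∈r s⊆t t⊆s
... | inj₁ s∈r | inj₂ (_ , _ , refl) = contradiction (t⊆s (here refl)) (∉-subfamilies x∉xs s∈r)
... | inj₂ (_ , _ , refl) | inj₁ t∈r = contradiction (s⊆t (here refl)) (∉-subfamilies x∉xs t∈r)
... | inj₂ (s′ , s′∈r , refl) | inj₂ (t′ , t′∈r , refl) =
  cong (x ∷_) (subfamilies-⊆-antisym u s′∈r t′∈r
    (⊆-∷⇒⊆ (∉-subfamilies x∉xs s′∈r) (s⊆t ∘ there))
    (⊆-∷⇒⊆ (∉-subfamilies x∉xs t′∈r) (t⊆s ∘ there)))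

HasPrivateElements : List (Subset n) → Set
HasPrivateElements {n} 𝓕 = ∀ S → S ∈ 𝓕 → ∃ λ (q : Fin n) → q ∈ˢ S × freq q 𝓕 ≡ 1

private∈⋃⇒∈ : ∀ {q : Fin n} {𝓕 S s} → freq q 𝓕 ≡ 1 → S ∈ 𝓕 → q ∈ˢ S →
              s ⊆ 𝓕 → q ∈ˢ ⋃ s → S ∈ s
private∈⋃⇒∈ {s = s} freq≡1 S∈𝓕 q∈S s⊆𝓕 q∈⋃s with x∈⋃⁻ s q∈⋃s
... | T , T∈s , q∈T = subst (_∈ s) (freq≡1⇒≡ freq≡1 (s⊆𝓕 T∈s) q∈T S∈𝓕 q∈S) T∈s

⋃-injectiveOn-subfamilies : ∀ {𝓕 : List (Subset n)} → Unique 𝓕 → HasPrivateElements 𝓕 →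
                            ∀ {s t} → s ∈ subfamilies 𝓕 → t ∈ subfamilies 𝓕 → ⋃ s ≡ ⋃ t → s ≡ t
⋃-injectiveOn-subfamilies {𝓕 = 𝓕} unique hasPrivate s∈ t∈ ⋃s≡⋃t =
  subfamilies-⊆-antisym unique s∈ t∈ (⋃≡⇒⊆ s∈ t∈ ⋃s≡⋃t) (⋃≡⇒⊆ t∈ s∈ (sym ⋃s≡⋃t))
  where
    ⋃≡⇒⊆ : ∀ {s t} → s ∈ subfamilies 𝓕 → t ∈ subfamilies 𝓕 → ⋃ s ≡ ⋃ t → s ⊆ t
    ⋃≡⇒⊆ s∈ t∈ ⋃s≡⋃t S∈s with hasPrivate _ (∈-subfamilies⇒⊆ 𝓕 s∈ S∈s)
    ... | q , q∈S , freq≡1 =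
      private∈⋃⇒∈ freq≡1 (∈-subfamilies⇒⊆ 𝓕 s∈ S∈s) q∈S (∈-subfamilies⇒⊆ 𝓕 t∈)
        (subst (q ∈ˢ_) ⋃s≡⋃t (x∈⋃⁺ q∈S S∈s))

⟨⟩≡map⋃subfamilies : ∀ {𝓕 : List (Subset n)} → Unique 𝓕 → HasPrivateElements 𝓕 →
                      ⟨ 𝓕 ⟩ ≡ map ⋃ (subfamilies 𝓕)
⟨⟩≡map⋃subfamilies unique hasPrivate =
  deduplicate-unique _≟ˢ_
    (map⁺-injectiveOn (⋃-injectiveOn-subfamilies unique hasPrivate) (subfamilies-unique unique))

private-element-halves : ∀ {p : Fin n} {A 𝓕} → Unique (A ∷ 𝓕) → p ∈ˢ A → freq p (A ∷ 𝓕) ≡ 1 →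
                         length (map ⋃ (subfamilies (A ∷ 𝓕))) ≡ 2 * freq p (map ⋃ (subfamilies (A ∷ 𝓕)))
private-element-halves {p = p} {A} {𝓕} (A∉𝓕 AllPairs.∷ _) p∈A freq≡1 = begin
  length (map ⋃ (r ++ map (A ∷_) r))      ≡⟨ length-map ⋃ (r ++ map (A ∷_) r) ⟩
  length (r ++ map (A ∷_) r)              ≡⟨ length-++ r ⟩
  length r + length (map (A ∷_) r)        ≡⟨ cong (length r +_) (length-map (A ∷_) r) ⟩
  length r + length r                     ≡⟨ cong (length r +_) (sym (+-identityʳ (length r))) ⟩
  2 * length r                            ≡⟨ cong (2 *_) (sym freq≡length) ⟩
  2 * freq p (map ⋃ (r ++ map (A ∷_) r))  ∎
  where
    open ≡-Reasoning
    r : List (List (Subset _))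
    r = subfamilies 𝓕
    avoiding : All (¬_ ∘ (p ∈ˢ_)) (map ⋃ r)
    avoiding = All.map⁺ (All.tabulate λ {s} s∈r p∈⋃s →
      ∉-subfamilies A∉𝓕 s∈r (private∈⋃⇒∈ freq≡1 (here refl) p∈A (there ∘ ∈-subfamilies⇒⊆ 𝓕 s∈r) p∈⋃s))
    containing : All (p ∈ˢ_) (map ⋃ (map (A ∷_) r))
    containing = All.map⁺ (All.map⁺ (All.universal (λ _ → x∈p∪q⁺ (inj₁ p∈A)) r))
    freq≡length : freq p (map ⋃ (r ++ map (A ∷_) r)) ≡ length r
    freq≡length = begin
      freq p (map ⋃ (r ++ map (A ∷_) r))                    ≡⟨ cong (freq p) (map-++ ⋃ r (map (A ∷_) r)) ⟩
      freq p (map ⋃ r ++ map ⋃ (map (A ∷_) r))              ≡⟨ freq-++ p (map ⋃ r) _ ⟩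
      freq p (map ⋃ r) + freq p (map ⋃ (map (A ∷_) r))      ≡⟨ cong₂ _+_ (freq-none avoiding) (freq-all containing) ⟩
      length (map ⋃ (map (A ∷_) r))                         ≡⟨ length-map ⋃ (map (A ∷_) r) ⟩
      length (map (A ∷_) r)                                 ≡⟨ length-map (A ∷_) r ⟩
      length r                                              ∎

corollary3p10 : (n : ℕ) (𝓕 : List (Subset n)) → Unique 𝓕 →
    (∀ A → A ∈ 𝓕 → ∃ λ (x : Fin n) → x ∈ˢ A × freq x 𝓕 ≡ 1) →
    SatisfiesUCC ⟨ 𝓕 ⟩
corollary3p10 n []       _      _          = inj₁ refl
corollary3p10 n (A ∷ 𝓕) unique hasPrivate with hasPrivate A (here refl)
... | p , p∈A , freq≡1 =
  subst SatisfiesUCC (sym (⟨⟩≡map⋃subfamilies unique hasPrivate))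
    (inj₂ (p , p∈⋃unions , ≤-reflexive (private-element-halves unique p∈A freq≡1)))
  where
    A∈unions : ⋃ (A ∷ []) ∈ map ⋃ (subfamilies (A ∷ 𝓕))
    A∈unions = ∈-map⁺ ⋃ (∈-++⁺ʳ (subfamilies 𝓕) (∈-map⁺ (A ∷_) ([]∈subfamilies 𝓕)))
    p∈⋃unions : p ∈ˢ ⋃ (map ⋃ (subfamilies (A ∷ 𝓕)))
    p∈⋃unions = x∈⋃⁺ (x∈p∪q⁺ (inj₁ p∈A)) A∈unions
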